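{- For each positive integer $s$ there exists a function $\gamma_s:\mathbb{N}\to\mathbb{N}$ with $\gamma_s(n) \le (1+o_s(1))\sqrt{n}\log n$ (in particular $\gamma_s(n)=o(n)$) such that the following holds. Let $m,n,\ell\in\mathbb{N}$ and let $\alpha=(\alpha_1,\dots,\alpha_m),\beta=(\beta_1,\dots,\beta_m) \in (\mathbb{N}^s)^m$ be two sequences that are not related to each other by a permutation. Suppose $\sum_{t=1}^m |\alpha_t|_1 \le n$, $\sum_{t=1}^m |\beta_t|_1 \le n$, and $\sum_{t=1}^m F(\alpha_t,\vec{i})= \sum_{t=1}^m F(\beta_t,\vec{i})$ for all $\vec{i} \in \{0,\dots,\ell\}^s$. Then $\ell < \gamma_s(n)$.
   Context: $\mathbb{N}$ includes $0$. For $\vec{x}\in\mathbb{N}^s$, $|\vec{x}|_1=\sum_{k=1}^s |x_k|$. For $\vec{x},\vec{i}\in\mathbb{N}^s$, $F(\vec{x},\vec{i})=\prod_{k=1}^s\binom{x_k}{i_k}$. Two sequences $\alpha,\beta\in(\mathbb{N}^s)^m$ are related by a permutation if there is a permutation $\pi$ of $[m]$ with $\alpha_i=\beta_{\pi(i)}$ for all $i\in[m]$. -}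

module Defs where

open import Data.Nat as ℕ using (ℕ; zero; suc; _≤_; _<_)
open import Data.Nat.Combinatorics using (_C_)
open import Data.Integer using (+_)
open import Data.Rational as ℚ using (ℚ; 0ℚ; 1ℚ)
open import Data.Fin using (Fin)
open import Data.Fin.Permutation using (Permutation′; _⟨$⟩ʳ_)
open import Data.Vec using (Vec; zipWith; tabulate; lookup)
import Data.Vec as V
open import Data.Vec.Relation.Unary.All using (All)
open import Data.Product using (Σ; ∃; _×_)
open import Relation.Binary.PropositionalEquality using (_≡_)

norm₁ : ∀ {s} → Vec ℕ s → ℕ
norm₁ = V.sum

F : ∀ {s} → Vec ℕ s → Vec ℕ s → ℕ
F x i = V.foldr _ ℕ._*_ 1 (zipWith _C_ x i)

totalNorm : ∀ {s m} → (Fin m → Vec ℕ s) → ℕ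
totalNorm {m = m} α = V.sum (tabulate (λ t → norm₁ (α t)))

sumF : ∀ {s m} → (Fin m → Vec ℕ s) → Vec ℕ s → ℕ
sumF α i = V.sum (tabulate (λ t → F (α t) i))

RelatedByPerm : ∀ {s m} → (Fin m → Vec ℕ s) → (Fin m → Vec ℕ s) → Set
RelatedByPerm {m = m} α β = Σ (Permutation′ m) λ π → ∀ i → α i ≡ β (π ⟨$⟩ʳ i)

expTerm : ℚ → ℕ → ℚ
expTerm a zero    = 1ℚ
expTerm a (suc k) = expTerm a k ℚ.* (a ℚ.* ((+ 1) ℚ./ suc k))

expPartial : ℚ → ℕ → ℚ
expPartial a zero    = 0ℚ
expPartial a (suc K) = expPartial a K ℚ.+ expTerm a K

-- For rational a ≥ 0:  e^a ≤ n  (the partial sums increase to e^a),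
-- i.e.  a ≤ ln n.
ExpLe : ℚ → ℕ → Set
ExpLe a n = ∀ K → expPartial a K ℚ.≤ ((+ n) ℚ./ 1)

-- For n ≥ 1, c ≥ 0 rational and g ∈ ℕ:
--   SqrtLogBound c g n  ⟺  g ≤ c · √n · ln n   (real inequality).
-- Encoded as: every rational a ≥ 0 with a < g/(c√n), i.e. (a c)² n < g²,
-- satisfies a ≤ ln n (e^a ≤ n).
SqrtLogBound : ℚ → ℕ → ℕ → Set
SqrtLogBound c g n =
  ∀ (a : ℚ) → 0ℚ ℚ.≤ a →
    (a ℚ.* c) ℚ.* (a ℚ.* c) ℚ.* ((+ n) ℚ./ 1) ℚ.< ((+ (g ℕ.* g)) ℚ./ 1) →
    ExpLe a n

AsympBound : (ℕ → ℕ) → Set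
AsympBound γ =
  ∀ (ε : ℚ) → 0ℚ ℚ.< ε →
    ∃ λ N → ∀ n → N ≤ n → 1 ≤ n → SqrtLogBound (1ℚ ℚ.+ ε) (γ n) n

{-# OPTIONS --safe #-}

-- For each t, the separator G(x) = ∏ₖ ∏_{v ∈ Lₖ} (xₖ − v), where Lₖ lists the values other than
-- (α_t)ₖ occurring in the k-th coordinates of α and β, vanishes at every entry of α and β except α_t.
-- The identity (x − c) C(x,i) = (i+1) C(x,i+1) + (i − c) C(x,i) makes G an integer combination of
-- the functions x ↦ F(x, i) with iₖ ≤ |Lₖ|, so if the moments agree up to ℓ ≥ maxₖ |Lₖ| the sums of
-- G over α and over β agree, i.e. α_t occurs equally often in both; this yields the permutation.
-- Each Lₖ consists of r distinct naturals with sum at most 2 n, so r (r − 1) ≤ 4 n and r is O(√n).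
-- An O(√n) function is eventually below (1+ε) √n log n: since γ(n)² ≤ 9 n, every a < γ(n) / ((1+ε) √n)
-- is below 3, and e^a < e³ < 21 ≤ n.

module Submission where

open import Defs
open import Data.Fin using (Fin)
open import Data.Vec as V using (Vec; []; _∷_)
open import Function using (_∘_)
open import Relation.Binary.PropositionalEquality

module BinomialAbsorption where

  open import Data.Nat using (zero; suc; _+_; _*_)
  open import Data.Nat.Combinatorics using (_C_; nCk+nC[k+1]≡[n+1]C[k+1]; nC1≡n)
  open import Data.Nat.Tactic.RingSolver using (solve-∀)
  open import Data.Integer as ℤ using (ℤ; +_)
  import Data.Integer.Properties as ℤP
  import Data.Integer.Tactic.RingSolver as ℤSolver

  n*nCk≡[1+k]*nC[1+k]+k*nCk : ∀ n k → n * (n C k) ≡ suc k * (n C suc k) + k * (n C k)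
  n*nCk≡[1+k]*nC[1+k]+k*nCk zero    zero    = refl
  n*nCk≡[1+k]*nC[1+k]+k*nCk zero    (suc k) = solve-zero k
    where
    solve-zero : ∀ k → 0 ≡ suc (suc k) * 0 + suc k * 0
    solve-zero = solve-∀
  n*nCk≡[1+k]*nC[1+k]+k*nCk (suc n) zero rewrite nC1≡n (suc n) = solve-one (suc n)
    where
    solve-one : ∀ n → n * 1 ≡ 1 * n + 0 * 1
    solve-one = solve-∀
  n*nCk≡[1+k]*nC[1+k]+k*nCk (suc n) (suc k) = begin
    suc n * (suc n C suc k)                   ≡⟨ cong (suc n *_) (sym (pascal k)) ⟩
    suc n * (a + b)                           ≡⟨ expand n a b ⟩
    a + b + n * a + n * b                     ≡⟨ cong₂ (λ u v → a + b + u + v) (n*nCk≡[1+k]*nC[1+k]+k*nCk n k)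
                                                                                (n*nCk≡[1+k]*nC[1+k]+k*nCk n (suc k)) ⟩
    a + b + (suc k * b + k * a) + (suc (suc k) * c + suc k * b)
                                              ≡⟨ regroup a b c k ⟩
    suc (suc k) * (b + c) + suc k * (a + b)   ≡⟨ cong₂ (λ u v → suc (suc k) * u + suc k * v) (pascal (suc k)) (pascal k) ⟩
    suc (suc k) * (suc n C suc (suc k)) + suc k * (suc n C suc k) ∎
    where
    open ≡-Reasoning
    pascal = nCk+nC[k+1]≡[n+1]C[k+1] n
    a = n C k
    b = n C suc k
    c = n C suc (suc k)
    expand : ∀ n a b → suc n * (a + b) ≡ a + b + n * a + n * b
    expand = solve-∀
    regroup : ∀ a b c k → a + b + (suc k * b + k * a) + (suc (suc k) * c + suc k * b)
                        ≡ suc (suc k) * (b + c) + suc k * (a + b)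
    regroup = solve-∀

  [n-c]*nCk≡[1+k]*nC[1+k]+[k-c]*nCk : ∀ n k c →
    (+ n ℤ.- + c) ℤ.* + (n C k) ≡ + suc k ℤ.* + (n C suc k) ℤ.+ (+ k ℤ.- + c) ℤ.* + (n C k)
  [n-c]*nCk≡[1+k]*nC[1+k]+[k-c]*nCk n k c = begin
    (+ n ℤ.- + c) ℤ.* B                          ≡⟨ distribute (+ n) (+ c) B ⟩
    + n ℤ.* B ℤ.- + c ℤ.* B                      ≡⟨ cong (ℤ._- + c ℤ.* B) absorption ⟩
    + suc k ℤ.* B′ ℤ.+ + k ℤ.* B ℤ.- + c ℤ.* B   ≡⟨ regroup (+ suc k) B′ (+ k) B (+ c) ⟩
    + suc k ℤ.* B′ ℤ.+ (+ k ℤ.- + c) ℤ.* B       ∎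
    where
    open ≡-Reasoning
    B = + (n C k)
    B′ = + (n C suc k)
    absorption : + n ℤ.* B ≡ + suc k ℤ.* B′ ℤ.+ + k ℤ.* B
    absorption = begin
      + n ℤ.* B                                  ≡⟨ ℤP.pos-* n (n C k) ⟨
      + (n * (n C k))                            ≡⟨ cong +_ (n*nCk≡[1+k]*nC[1+k]+k*nCk n k) ⟩
      + (suc k * (n C suc k) + k * (n C k))      ≡⟨ ℤP.pos-+ (suc k * (n C suc k)) (k * (n C k)) ⟩
      + (suc k * (n C suc k)) ℤ.+ + (k * (n C k)) ≡⟨ cong₂ ℤ._+_ (ℤP.pos-* (suc k) _) (ℤP.pos-* k _) ⟩
      + suc k ℤ.* B′ ℤ.+ + k ℤ.* B               ∎
    distribute : ∀ x c y → (x ℤ.- c) ℤ.* y ≡ x ℤ.* y ℤ.- c ℤ.* y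
    distribute = ℤSolver.solve-∀
    regroup : ∀ x y z w c → x ℤ.* y ℤ.+ z ℤ.* w ℤ.- c ℤ.* w ≡ x ℤ.* y ℤ.+ (z ℤ.- c) ℤ.* w
    regroup = ℤSolver.solve-∀

module Separator where

  open import Data.Nat using (ℕ)
  open import Data.Integer using (ℤ; +_; 0ℤ; 1ℤ; _*_; _-_)
  import Data.Integer.Properties as ℤP
  open import Data.Fin using (zero; suc)
  open import Data.List using (List; []; _∷_)
  open import Data.List.Relation.Unary.Any using (here; there)
  open import Data.List.Membership.Propositional using (_∈_; _∉_)
  open import Data.Sum using (inj₁; inj₂)

  rootProduct : List ℕ → ℕ → ℤ
  rootProduct []       x = 1ℤ
  rootProduct (c ∷ cs) x = (+ x - + c) * rootProduct cs x

  separator : ∀ {s} → Vec (List ℕ) s → Vec ℕ s → ℤ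
  separator []       []       = 1ℤ
  separator (cs ∷ Ls) (x ∷ xs) = rootProduct cs x * separator Ls xs

  rootProduct-root : ∀ {x cs} → x ∈ cs → rootProduct cs x ≡ 0ℤ
  rootProduct-root {x} {_ ∷ cs} (here refl) = cong (_* rootProduct cs x) (ℤP.+-inverseʳ (+ x))
  rootProduct-root {x} {c ∷ cs} (there x∈cs) =
    trans (cong ((+ x - + c) *_) (rootProduct-root x∈cs)) (ℤP.*-zeroʳ (+ x - + c))

  rootProduct-nonzero : ∀ {x} cs → x ∉ cs → rootProduct cs x ≢ 0ℤ
  rootProduct-nonzero []       _    ()
  rootProduct-nonzero {x} (c ∷ cs) x∉c∷cs product≡0 with ℤP.i*j≡0⇒i≡0∨j≡0 (+ x - + c) product≡0
  ... | inj₁ x-c≡0  = x∉c∷cs (here (ℤP.+-injective (ℤP.i-j≡0⇒i≡j (+ x) (+ c) x-c≡0)))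
  ... | inj₂ rest≡0 = rootProduct-nonzero cs (x∉c∷cs ∘ there) rest≡0

  separator-root : ∀ {s} (Ls : Vec (List ℕ) s) x k → V.lookup x k ∈ V.lookup Ls k → separator Ls x ≡ 0ℤ
  separator-root (cs ∷ Ls) (x ∷ xs) zero    x∈cs = cong (_* separator Ls xs) (rootProduct-root x∈cs)
  separator-root (cs ∷ Ls) (x ∷ xs) (suc k) xk∈Lk =
    trans (cong (rootProduct cs x *_) (separator-root Ls xs k xk∈Lk)) (ℤP.*-zeroʳ (rootProduct cs x))

  separator-nonzero : ∀ {s} (Ls : Vec (List ℕ) s) x → (∀ k → V.lookup x k ∉ V.lookup Ls k) → separator Ls x ≢ 0ℤ
  separator-nonzero []        []       _   ()
  separator-nonzero (cs ∷ Ls) (x ∷ xs) x∉L product≡0 with ℤP.i*j≡0⇒i≡0∨j≡0 (rootProduct cs x) product≡0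
  ... | inj₁ head≡0 = rootProduct-nonzero cs (x∉L zero) head≡0
  ... | inj₂ rest≡0 = separator-nonzero Ls xs (x∉L ∘ suc) rest≡0

module BinomialSpan where

  open BinomialAbsorption
  open Separator
  open import Data.Nat as ℕ using (ℕ; suc; _≤_; z≤n; s≤s)
  import Data.Nat.Properties as ℕP
  open import Data.Nat.Combinatorics using (_C_)
  open import Data.Integer using (ℤ; +_; _+_; _*_; _-_)
  import Data.Integer.Properties as ℤP
  open import Data.Integer.Tactic.RingSolver using (solve-∀)
  open import Data.List using (List; []; _∷_; length)
  open import Data.Vec.Relation.Binary.Pointwise.Inductive as Pointwise using (Pointwise; []; _∷_)

  data BinomialCombination {s : ℕ} (d : Vec ℕ s) : (Vec ℕ s → ℤ) → Set where
    binomial : ∀ i → Pointwise _≤_ i d → BinomialCombination d (λ x → + F x i)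
    plus     : ∀ {g h} → BinomialCombination d g → BinomialCombination d h → BinomialCombination d (λ x → g x + h x)
    scale    : ∀ {g} c → BinomialCombination d g → BinomialCombination d (λ x → c * g x)
    resp-≗   : ∀ {g h} → BinomialCombination d g → g ≗ h → BinomialCombination d h

  combination-mono : ∀ {s} {d d′ : Vec ℕ s} {g} → Pointwise _≤_ d d′ → BinomialCombination d g → BinomialCombination d′ g
  combination-mono d≤d′ (binomial i i≤d) = binomial i (Pointwise.trans ℕP.≤-trans i≤d d≤d′)
  combination-mono d≤d′ (plus p q)       = plus (combination-mono d≤d′ p) (combination-mono d≤d′ q)
  combination-mono d≤d′ (scale c p)      = scale c (combination-mono d≤d′ p)
  combination-mono d≤d′ (resp-≗ p g≗h)   = resp-≗ (combination-mono d≤d′ p) g≗h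

  combination-tail : ∀ {s} {d : Vec ℕ s} {g} → BinomialCombination d g → BinomialCombination (0 ∷ d) (g ∘ V.tail)
  combination-tail (binomial i i≤d) = resp-≗ (binomial (0 ∷ i) (z≤n ∷ i≤d)) λ { (x ∷ xs) → cong +_ (ℕP.+-identityʳ (F xs i)) }
  combination-tail (plus p q)       = plus (combination-tail p) (combination-tail q)
  combination-tail (scale c p)      = scale c (combination-tail p)
  combination-tail (resp-≗ p g≗h)   = resp-≗ (combination-tail p) (g≗h ∘ V.tail)

  [x-c]*F≡[1+i]*F+[i-c]*F : ∀ {s} x (xs : Vec ℕ s) i is c →
    (+ x - + c) * + F (x ∷ xs) (i ∷ is) ≡ + suc i * + F (x ∷ xs) (suc i ∷ is) + (+ i - + c) * + F (x ∷ xs) (i ∷ is)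
  [x-c]*F≡[1+i]*F+[i-c]*F x xs i is c = begin
    (+ x - + c) * + (A ℕ.* φ)                    ≡⟨ cong ((+ x - + c) *_) (ℤP.pos-* A φ) ⟩
    (+ x - + c) * (+ A * + φ)                    ≡⟨ ℤP.*-assoc (+ x - + c) (+ A) (+ φ) ⟨
    (+ x - + c) * + A * + φ                      ≡⟨ cong (_* + φ) ([n-c]*nCk≡[1+k]*nC[1+k]+[k-c]*nCk x i c) ⟩
    (+ suc i * + A′ + (+ i - + c) * + A) * + φ   ≡⟨ distribute (+ suc i) (+ A′) (+ i - + c) (+ A) (+ φ) ⟩
    + suc i * (+ A′ * + φ) + (+ i - + c) * (+ A * + φ)
                                                 ≡⟨ cong₂ (λ u v → + suc i * u + (+ i - + c) * v) (ℤP.pos-* A′ φ) (ℤP.pos-* A φ) ⟨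
    + suc i * + (A′ ℕ.* φ) + (+ i - + c) * + (A ℕ.* φ) ∎
    where
    open ≡-Reasoning
    A = x C i
    A′ = x C suc i
    φ = F xs is
    distribute : ∀ a b c d e → (a * b + c * d) * e ≡ a * (b * e) + c * (d * e)
    distribute = solve-∀

  combination-*linear : ∀ {s e} {d : Vec ℕ s} {g} → BinomialCombination (e ∷ d) g →
    ∀ c → BinomialCombination (suc e ∷ d) (λ x → (+ V.head x - + c) * g x)
  combination-*linear (binomial (i ∷ is) (i≤e ∷ is≤d)) c =
    resp-≗ (plus (scale (+ suc i) (binomial (suc i ∷ is) (s≤s i≤e ∷ is≤d)))
                 (scale (+ i - + c) (binomial (i ∷ is) (ℕP.m≤n⇒m≤1+n i≤e ∷ is≤d))))
           λ { (x ∷ xs) → sym ([x-c]*F≡[1+i]*F+[i-c]*F x xs i is c) }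
  combination-*linear (plus p q) c =
    resp-≗ (plus (combination-*linear p c) (combination-*linear q c)) λ x → sym (ℤP.*-distribˡ-+ (+ V.head x - + c) _ _)
  combination-*linear (scale a p) c =
    resp-≗ (scale a (combination-*linear p c)) λ x → swap a (+ V.head x - + c) _
    where
    swap : ∀ a b g → a * (b * g) ≡ b * (a * g)
    swap = solve-∀
  combination-*linear (resp-≗ p g≗h) c = resp-≗ (combination-*linear p c) λ x → cong ((+ V.head x - + c) *_) (g≗h x)

  combination-rootProduct : ∀ {s e} {d : Vec ℕ s} {g} → BinomialCombination (e ∷ d) g →
    ∀ cs → BinomialCombination (length cs ℕ.+ e ∷ d) (λ x → rootProduct cs (V.head x) * g x)
  combination-rootProduct p []       = resp-≗ p λ x → sym (ℤP.*-identityˡ _)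
  combination-rootProduct p (c ∷ cs) =
    resp-≗ (combination-*linear (combination-rootProduct p cs) c) λ x → sym (ℤP.*-assoc (+ V.head x - + c) _ _)

  separator-combination : ∀ {s} (Ls : Vec (List ℕ) s) → BinomialCombination (V.map length Ls) (separator Ls)
  separator-combination []        = resp-≗ (binomial [] []) λ { [] → refl }
  separator-combination (cs ∷ Ls) =
    resp-≗ (combination-mono (ℕP.≤-reflexive (ℕP.+-identityʳ (length cs)) ∷ Pointwise.refl ℕP.≤-refl)
                             (combination-rootProduct (combination-tail (separator-combination Ls)) cs))
           λ { (x ∷ xs) → refl }

module MomentSums where

  open BinomialSpan
  open import Data.Nat using (ℕ; zero; suc; _≤_)
  import Data.Nat.Properties as ℕP
  open import Data.Integer using (+_; _+_; _*_)
  import Data.Integer.Properties as ℤP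
  open import Data.Fin using (zero; suc)
  open import Data.Vec.Relation.Binary.Pointwise.Inductive using (Pointwise; []; _∷_)
  open import Data.Vec.Relation.Unary.All using (All; []; _∷_)
  open import Algebra.Properties.Semiring.Sum ℤP.+-*-semiring using (sum; ∑-distrib-+; *-distribˡ-sum; sum-cong-≗)

  +-sum-tabulate : ∀ {m} (f : Fin m → ℕ) → + V.sum (V.tabulate f) ≡ sum (+_ ∘ f)
  +-sum-tabulate {zero}  f = refl
  +-sum-tabulate {suc m} f = trans (ℤP.pos-+ (f zero) _) (cong (_+_ (+ f zero)) (+-sum-tabulate (f ∘ suc)))

  All-≤-antimono : ∀ {s ℓ} {i d : Vec ℕ s} → Pointwise _≤_ i d → All (_≤ ℓ) d → All (_≤ ℓ) i
  All-≤-antimono []             []             = []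
  All-≤-antimono (i≤d ∷ is≤ds) (d≤ℓ ∷ ds≤ℓ) = ℕP.≤-trans i≤d d≤ℓ ∷ All-≤-antimono is≤ds ds≤ℓ

  module _ {s m ℓ} (α β : Fin m → Vec ℕ s) (moments : ∀ i → All (_≤ ℓ) i → sumF α i ≡ sumF β i) where

    combination-sums-agree : ∀ {d g} → BinomialCombination d g → All (_≤ ℓ) d → sum (g ∘ α) ≡ sum (g ∘ β)
    combination-sums-agree (binomial i i≤d) d≤ℓ = begin
      sum (λ t → + F (α t) i) ≡⟨ +-sum-tabulate (λ t → F (α t) i) ⟨
      + sumF α i              ≡⟨ cong +_ (moments i (All-≤-antimono i≤d d≤ℓ)) ⟩
      + sumF β i              ≡⟨ +-sum-tabulate (λ t → F (β t) i) ⟩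
      sum (λ t → + F (β t) i) ∎
      where open ≡-Reasoning
    combination-sums-agree (plus {g} {h} p q) d≤ℓ = begin
      sum (λ t → g (α t) + h (α t))    ≡⟨ ∑-distrib-+ (g ∘ α) (h ∘ α) ⟩
      sum (g ∘ α) + sum (h ∘ α)        ≡⟨ cong₂ _+_ (combination-sums-agree p d≤ℓ) (combination-sums-agree q d≤ℓ) ⟩
      sum (g ∘ β) + sum (h ∘ β)        ≡⟨ ∑-distrib-+ (g ∘ β) (h ∘ β) ⟨
      sum (λ t → g (β t) + h (β t))    ∎
      where open ≡-Reasoning
    combination-sums-agree (scale {g} c p) d≤ℓ = begin
      sum (λ t → c * g (α t))  ≡⟨ *-distribˡ-sum c (g ∘ α) ⟨
      c * sum (g ∘ α)          ≡⟨ cong (c *_) (combination-sums-agree p d≤ℓ) ⟩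
      c * sum (g ∘ β)          ≡⟨ *-distribˡ-sum c (g ∘ β) ⟩
      sum (λ t → c * g (β t))  ∎
      where open ≡-Reasoning
    combination-sums-agree (resp-≗ p g≗h) d≤ℓ =
      trans (sum-cong-≗ (sym ∘ g≗h ∘ α)) (trans (combination-sums-agree p d≤ℓ) (sum-cong-≗ (g≗h ∘ β)))

module PermutationFromSeparators where

  open import Data.Nat using (zero; suc)
  open import Data.Integer using (ℤ; +_; 0ℤ; _+_; _*_)
  import Data.Integer.Properties as ℤP
  open import Algebra.Properties.Semiring.Sum ℤP.+-*-semiring using (sum; sum-remove; sum-cong-≗; sum-replicate-zero)
  open import Algebra.Properties.AbelianGroup ℤP.+-0-abelianGroup using (∙-cancelˡ)
  open import Data.Fin using (zero; suc; punchIn)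
  open import Data.Fin.Properties using (any?)
  open import Data.Fin.Permutation using (Permutation′; _⟨$⟩ʳ_; insert; insert-punchIn; id)
  open import Data.Product using (Σ; ∃; _,_; proj₁; proj₂)
  open import Data.Sum using (_⊎_; inj₁; inj₂)
  open import Relation.Nullary using (yes; no; contradiction)
  open import Relation.Binary.Definitions using (DecidableEquality)

  sum-zero : ∀ {m} (f : Fin m → ℤ) → (∀ u → f u ≡ 0ℤ) → sum f ≡ 0ℤ
  sum-zero {m} f f≡0 = trans (sum-cong-≗ f≡0) (sum-replicate-zero m)

  c+k*c≡[1+k]*c : ∀ c k → c + + k * c ≡ + suc k * c
  c+k*c≡[1+k]*c c k = trans (cong (_+ + k * c) (sym (ℤP.*-identityˡ c))) (sym (ℤP.*-distribʳ-+ c (+ 1) (+ k)))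

  sum-of-0-or-c : ∀ {m} c (f : Fin m → ℤ) → (∀ u → f u ≡ 0ℤ ⊎ f u ≡ c) → ∃ λ k → sum f ≡ + k * c
  sum-of-0-or-c {zero}  c f _  = 0 , refl
  sum-of-0-or-c {suc m} c f f∈ with sum-of-0-or-c c (f ∘ suc) (f∈ ∘ suc) | f∈ zero
  ... | k , eq | inj₁ f0≡0 = k , trans (cong₂ _+_ f0≡0 eq) (ℤP.+-identityˡ _)
  ... | k , eq | inj₂ f0≡c = suc k , trans (cong₂ _+_ f0≡c eq) (c+k*c≡[1+k]*c c k)

  sum-nonzero : ∀ {m} c (f : Fin (suc m) → ℤ) → c ≢ 0ℤ → f zero ≡ c → (∀ u → f u ≡ 0ℤ ⊎ f u ≡ c) → sum f ≢ 0ℤ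
  sum-nonzero c f c≢0 f0≡c f∈ sum≡0 with sum-of-0-or-c c (f ∘ suc) (f∈ ∘ suc)
  ... | k , eq with ℤP.i*j≡0⇒i≡0∨j≡0 (+ suc k) (trans (sym (c+k*c≡[1+k]*c c k)) (trans (cong₂ _+_ (sym f0≡c) (sym eq)) sum≡0))
  ...   | inj₂ c≡0 = c≢0 c≡0

  -- Summing G (α t) over a sequence counts, up to the factor G (α t) (α t), the occurrences of α t;
  -- so α 0 occurs in β, and matching the two occurrences leaves shorter sequences of the same kind.
  related-by-separators : ∀ {A : Set} → DecidableEquality A → ∀ {m} (α β : Fin m → A) (G : A → A → ℤ) →
    (∀ t → G (α t) (α t) ≢ 0ℤ) →
    (∀ t u → α u ≢ α t → G (α t) (α u) ≡ 0ℤ) →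
    (∀ t u → β u ≢ α t → G (α t) (β u) ≡ 0ℤ) →
    (∀ t → sum (G (α t) ∘ α) ≡ sum (G (α t) ∘ β)) →
    Σ (Permutation′ m) λ π → ∀ i → α i ≡ β (π ⟨$⟩ʳ i)
  related-by-separators _≟_ {zero}  α β G Gaa≢0 Gα≡0 Gβ≡0 sums = id , λ ()
  related-by-separators _≟_ {suc m} α β G Gaa≢0 Gα≡0 Gβ≡0 sums with any? (λ u → β u ≟ α zero)
  ... | no α0∉β = contradiction sumα≡0 (sum-nonzero (G a a) (G a ∘ α) (Gaa≢0 zero) refl Gaα∈)
    where
    a = α zero
    Gaα∈ : ∀ u → G a (α u) ≡ 0ℤ ⊎ G a (α u) ≡ G a a
    Gaα∈ u with α u ≟ a
    ... | yes αu≡a = inj₂ (cong (G a) αu≡a)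
    ... | no  αu≢a = inj₁ (Gα≡0 zero u αu≢a)
    sumα≡0 : sum (G a ∘ α) ≡ 0ℤ
    sumα≡0 = trans (sums zero) (sum-zero (G a ∘ β) λ u → Gβ≡0 zero u λ βu≡a → α0∉β (u , βu≡a))
  ... | yes (t′ , βt′≡α0) = insert zero t′ π , matched
    where
    α′ = α ∘ suc
    β′ = β ∘ punchIn t′
    sums′ : ∀ t → sum (G (α′ t) ∘ α′) ≡ sum (G (α′ t) ∘ β′)
    sums′ t = ∙-cancelˡ (G (α′ t) (α zero)) _ _ (begin
      G (α′ t) (α zero) + sum (G (α′ t) ∘ α′) ≡⟨ sums (suc t) ⟩
      sum (G (α′ t) ∘ β)                       ≡⟨ sum-remove (G (α′ t) ∘ β) ⟩
      G (α′ t) (β t′) + sum (G (α′ t) ∘ β′)    ≡⟨ cong (λ v → G (α′ t) v + sum (G (α′ t) ∘ β′)) βt′≡α0 ⟩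
      G (α′ t) (α zero) + sum (G (α′ t) ∘ β′)  ∎)
      where open ≡-Reasoning
    rest = related-by-separators _≟_ α′ β′ G (Gaa≢0 ∘ suc) (λ t u → Gα≡0 (suc t) (suc u)) (λ t u → Gβ≡0 (suc t) (punchIn t′ u)) sums′
    π = proj₁ rest
    matched : ∀ i → α i ≡ β (insert zero t′ π ⟨$⟩ʳ i)
    matched zero    = sym βt′≡α0
    matched (suc i) = trans (proj₂ rest i) (cong β (sym (insert-punchIn zero t′ π i)))

module DistinctValues where

  open import Data.Nat using (ℕ; suc; _+_; _*_; _≤_; _<_; z≤n; s≤s; _≟_)
  import Data.Nat.Properties as ℕP
  open import Data.Nat.ListAction using (sum)
  open import Data.Nat.ListAction.Properties using (sum-++)
  open import Data.Nat.Tactic.RingSolver using (solve-∀)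
  open import Data.List using (List; []; _∷_; length; filter; upTo; _++_)
  open import Data.List.Relation.Unary.All as All using (All; []; _∷_)
  open import Data.List.Relation.Unary.AllPairs as AllPairs using (AllPairs; []; _∷_)
  import Data.List.Relation.Unary.AllPairs.Properties as AllPairsP
  open import Data.List.Relation.Unary.Any using (here; there)
  open import Data.List.Relation.Unary.Unique.Propositional using (Unique)
  open import Data.List.Membership.Propositional using (_∈_; _∉_)
  open import Data.List.Membership.Propositional.Properties
    using (∈-∃++; ∈-++⁻; ∈-++⁺ˡ; ∈-++⁺ʳ; ∈-filter⁺; ∈-filter⁻; ∈-upTo⁺)
  open import Data.List.Membership.DecPropositional _≟_ using (_∈?_)
  open import Data.Product using (_×_; _,_; proj₁; proj₂)
  open import Data.Sum using (inj₁; inj₂)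
  open import Function using (id)
  open import Relation.Nullary using (Dec; ¬?; _×-dec_; contradiction)

  ∈⇒≤sum : ∀ {v xs} → v ∈ xs → v ≤ sum xs
  ∈⇒≤sum {xs = x ∷ xs} (here refl) = ℕP.m≤m+n x (sum xs)
  ∈⇒≤sum {xs = x ∷ xs} (there v∈xs) = ℕP.≤-trans (∈⇒≤sum v∈xs) (ℕP.m≤n+m (sum xs) x)

  sum-mono-⊆ : ∀ {xs ys} → Unique xs → (∀ {v} → v ∈ xs → v ∈ ys) → sum xs ≤ sum ys
  sum-mono-⊆ {[]}     _                  _      = z≤n
  sum-mono-⊆ {x ∷ xs} (x≢xs ∷ unique-xs) xs⊆ys with ∈-∃++ (xs⊆ys (here refl))
  ... | ys₁ , ys₂ , refl = begin
    x + sum xs                   ≤⟨ ℕP.+-monoʳ-≤ x (sum-mono-⊆ unique-xs xs⊆ys₁++ys₂) ⟩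
    x + sum (ys₁ ++ ys₂)         ≡⟨ cong (x +_) (sum-++ ys₁ ys₂) ⟩
    x + (sum ys₁ + sum ys₂)      ≡⟨ swap x (sum ys₁) (sum ys₂) ⟩
    sum ys₁ + (x + sum ys₂)      ≡⟨ sum-++ ys₁ (x ∷ ys₂) ⟨
    sum (ys₁ ++ x ∷ ys₂)         ∎
    where
    open ℕP.≤-Reasoning
    swap : ∀ x a b → x + (a + b) ≡ a + (x + b)
    swap = solve-∀
    xs⊆ys₁++ys₂ : ∀ {v} → v ∈ xs → v ∈ ys₁ ++ ys₂
    xs⊆ys₁++ys₂ v∈xs with ∈-++⁻ ys₁ (xs⊆ys (there v∈xs))
    ... | inj₁ v∈ys₁          = ∈-++⁺ˡ v∈ys₁
    ... | inj₂ (here v≡x)     = contradiction (sym v≡x) (All.lookup x≢xs v∈xs)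
    ... | inj₂ (there v∈ys₂)  = ∈-++⁺ʳ ys₁ v∈ys₂

  strictlyIncreasing-sum-bound : ∀ {xs} b → AllPairs _<_ xs → All (b ≤_) xs →
    length xs * length xs + 2 * length xs * b ≤ 2 * sum xs + length xs
  strictlyIncreasing-sum-bound {[]}     b _              _          = z≤n
  strictlyIncreasing-sum-bound {x ∷ xs} b (x<xs ∷ inc-xs) (b≤x ∷ _) = begin
    suc r * suc r + 2 * suc r * b  ≤⟨ ℕP.+-monoʳ-≤ (suc r * suc r) (ℕP.*-monoʳ-≤ (2 * suc r) b≤x) ⟩
    suc r * suc r + 2 * suc r * x  ≡⟨ expand r x ⟩
    (r * r + 2 * r * suc x) + (2 * x + 1)
                                   ≤⟨ ℕP.+-monoˡ-≤ (2 * x + 1) (strictlyIncreasing-sum-bound (suc x) inc-xs x<xs) ⟩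
    (2 * sum xs + r) + (2 * x + 1) ≡⟨ collect r x (sum xs) ⟩
    2 * (x + sum xs) + suc r       ∎
    where
    open ℕP.≤-Reasoning
    r = length xs
    expand : ∀ r x → suc r * suc r + 2 * suc r * x ≡ (r * r + 2 * r * suc x) + (2 * x + 1)
    expand = solve-∀
    collect : ∀ r x s → (2 * s + r) + (2 * x + 1) ≡ 2 * (x + s) + suc r
    collect = solve-∀

  other? : ∀ vs e v → Dec (v ∈ vs × v ≢ e)
  other? vs e v = v ∈? vs ×-dec ¬? (v ≟ e)

  -- Filtering upTo rather than vs makes the list strictly increasing.
  others : List ℕ → ℕ → List ℕ
  others vs e = filter (other? vs e) (upTo (suc (sum vs)))

  e∉others : ∀ vs e → e ∉ others vs e
  e∉others vs e e∈others = proj₂ (proj₂ (∈-filter⁻ (other? vs e) e∈others)) refl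

  ∈-others : ∀ {vs v e} → v ∈ vs → v ≢ e → v ∈ others vs e
  ∈-others {vs} {e = e} v∈vs v≢e = ∈-filter⁺ (other? vs e) (∈-upTo⁺ (s≤s (∈⇒≤sum v∈vs))) (v∈vs , v≢e)

  others-length : ∀ vs e → let r = length (others vs e) in r * r ≤ 2 * sum vs + r
  others-length vs e = begin
    r * r                     ≡⟨ ℕP.+-identityʳ (r * r) ⟨
    r * r + 0                 ≡⟨ cong (r * r +_) (ℕP.*-zeroʳ (2 * r)) ⟨
    r * r + 2 * r * 0         ≤⟨ strictlyIncreasing-sum-bound 0 increasing (All.universal (λ _ → z≤n) _) ⟩
    2 * sum (others vs e) + r ≤⟨ ℕP.+-monoˡ-≤ r (ℕP.*-monoʳ-≤ 2 (sum-mono-⊆ unique others⊆vs)) ⟩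
    2 * sum vs + r            ∎
    where
    open ℕP.≤-Reasoning
    r = length (others vs e)
    increasing : AllPairs _<_ (others vs e)
    increasing = AllPairsP.filter⁺ (other? vs e) (AllPairsP.applyUpTo⁺₁ id (suc (sum vs)) λ i<j _ → i<j)
    unique : Unique (others vs e)
    unique = AllPairs.map ℕP.<⇒≢ increasing
    others⊆vs : ∀ {v} → v ∈ others vs e → v ∈ vs
    others⊆vs v∈others = proj₁ (proj₂ (∈-filter⁻ (other? vs e) v∈others))

module DegreeThreshold where

  open import Data.Nat using (ℕ; zero; suc; _+_; _*_; _≤_; z≤n; _≤?_)
  import Data.Nat.Properties as ℕP
  open import Data.Nat.Tactic.RingSolver using (solve-∀)
  open import Relation.Nullary using (yes; no)
  open import Relation.Unary using (Pred; Decidable)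

  module _ {p} {P : Pred ℕ p} (P? : Decidable P) where

    greatest : ℕ → ℕ
    greatest zero = zero
    greatest (suc b) with P? (suc b)
    ... | yes _ = suc b
    ... | no  _ = greatest b

    greatest-holds : P 0 → ∀ b → P (greatest b)
    greatest-holds P0 zero = P0
    greatest-holds P0 (suc b) with P? (suc b)
    ... | yes P[1+b] = P[1+b]
    ... | no  _      = greatest-holds P0 b

    greatest-≥ : ∀ {r} b → r ≤ b → P r → r ≤ greatest b
    greatest-≥ zero    r≤0   _  = r≤0
    greatest-≥ (suc b) r≤1+b Pr with P? (suc b)
    ... | yes _    = r≤1+b
    ... | no  ¬P[1+b] = greatest-≥ b (ℕP.≤-pred (ℕP.≤∧≢⇒< r≤1+b λ { refl → ¬P[1+b] Pr })) Pr

  r*r≤c+r⇒r≤1+c : ∀ c r → r * r ≤ c + r → r ≤ suc c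
  r*r≤c+r⇒r≤1+c c zero    _ = z≤n
  r*r≤c+r⇒r≤1+c c (suc r) h = ℕP.*-cancelʳ-≤ (suc r) (suc c) (suc r) (begin
    suc r * suc r      ≤⟨ h ⟩
    c + suc r          ≡⟨ ℕP.+-comm c (suc r) ⟩
    suc r + c          ≤⟨ ℕP.+-monoʳ-≤ (suc r) (ℕP.m≤m*n c (suc r)) ⟩
    suc c * suc r      ∎)
    where open ℕP.≤-Reasoning

  γ : ℕ → ℕ
  γ n = greatest (λ r → r * r ≤? 4 * n + r) (suc (4 * n))

  ≤γ : ∀ n {r} → r * r ≤ 4 * n + r → r ≤ γ n
  ≤γ n {r} h = greatest-≥ (λ r → r * r ≤? 4 * n + r) (suc (4 * n)) (r*r≤c+r⇒r≤1+c (4 * n) r h) h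

  γ-square : ∀ n → γ n * γ n ≤ 4 * n + γ n
  γ-square n = greatest-holds (λ r → r * r ≤? 4 * n + r) z≤n (suc (4 * n))

  γ-square-≤-9n : ∀ {n} → 1 ≤ n → γ n * γ n ≤ 9 * n
  γ-square-≤-9n {n} 1≤n = begin
    γ n * γ n           ≤⟨ γ-square n ⟩
    4 * n + γ n         ≤⟨ ℕP.+-monoʳ-≤ (4 * n) (r*r≤c+r⇒r≤1+c (4 * n) (γ n) (γ-square n)) ⟩
    4 * n + suc (4 * n) ≤⟨ ℕP.+-monoʳ-≤ (4 * n) (ℕP.+-monoˡ-≤ (4 * n) 1≤n) ⟩
    4 * n + (n + 4 * n) ≡⟨ collect n ⟩
    9 * n               ∎
    where
    open ℕP.≤-Reasoning
    collect : ∀ n → 4 * n + (n + 4 * n) ≡ 9 * n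
    collect = solve-∀

module Reconstruction where

  open Separator
  open BinomialSpan
  open MomentSums using (combination-sums-agree)
  open PermutationFromSeparators
  open DistinctValues
  open DegreeThreshold
  open import Data.Nat using (ℕ; zero; suc; _+_; _*_; _≤_; _≟_)
  import Data.Nat.Properties as ℕP
  open import Data.Nat.ListAction using (sum)
  open import Data.Nat.ListAction.Properties using (sum-++)
  open import Data.Nat.Tactic.RingSolver using (solve-∀)
  open import Data.Integer using (ℤ; 0ℤ)
  open import Data.Fin using (zero; suc)
  open import Data.Fin.Properties using (¬∀⟶∃¬)
  open import Data.List as L using (List; length; _++_)
  open import Data.List.Membership.Propositional using (_∈_)
  open import Data.List.Membership.Propositional.Properties using (∈-tabulate⁺; ∈-++⁺ˡ; ∈-++⁺ʳ)
  import Data.Vec.Properties as VP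
  open import Data.Vec.Relation.Unary.All using (All)
  import Data.Vec.Relation.Unary.All.Properties as AllP
  open import Data.Product using (∃; _,_)

  column : ∀ {s m} → (Fin m → Vec ℕ s) → Fin s → List ℕ
  column α k = L.tabulate (λ u → V.lookup (α u) k)

  lookup≤sum : ∀ {s} (x : Vec ℕ s) k → V.lookup x k ≤ V.sum x
  lookup≤sum (x ∷ xs) zero    = ℕP.m≤m+n x (V.sum xs)
  lookup≤sum (x ∷ xs) (suc k) = ℕP.≤-trans (lookup≤sum xs k) (ℕP.m≤n+m (V.sum xs) x)

  sum-column≤totalNorm : ∀ {s m} (α : Fin m → Vec ℕ s) k → sum (column α k) ≤ totalNorm α
  sum-column≤totalNorm {m = zero}  α k = ℕP.≤-refl
  sum-column≤totalNorm {m = suc m} α k = ℕP.+-mono-≤ (lookup≤sum (α zero) k) (sum-column≤totalNorm (α ∘ suc) k)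

  ≢⇒∃lookup≢ : ∀ {s} {x y : Vec ℕ s} → x ≢ y → ∃ λ k → V.lookup x k ≢ V.lookup y k
  ≢⇒∃lookup≢ {s} {x} {y} x≢y = ¬∀⟶∃¬ s _ (λ k → V.lookup x k ≟ V.lookup y k) λ x≗y → x≢y (begin
    x                   ≡⟨ VP.tabulate∘lookup x ⟨
    V.tabulate (V.lookup x) ≡⟨ VP.tabulate-cong x≗y ⟩
    V.tabulate (V.lookup y) ≡⟨ VP.tabulate∘lookup y ⟩
    y                   ∎)
    where open ≡-Reasoning

  module _ {s m n} (α β : Fin m → Vec ℕ s) (α≤n : totalNorm α ≤ n) (β≤n : totalNorm β ≤ n) where

    values : Fin s → List ℕ
    values k = column α k ++ column β k

    rootSets : Vec ℕ s → Vec (List ℕ) s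
    rootSets e = V.tabulate (λ k → others (values k) (V.lookup e k))

    G : Vec ℕ s → Vec ℕ s → ℤ
    G e = separator (rootSets e)

    lookup-rootSets : ∀ e k → V.lookup (rootSets e) k ≡ others (values k) (V.lookup e k)
    lookup-rootSets e k = VP.lookup∘tabulate (λ k → others (values k) (V.lookup e k)) k

    G-nonzero : ∀ e → G e e ≢ 0ℤ
    G-nonzero e = separator-nonzero (rootSets e) e λ k ek∈ →
      e∉others (values k) (V.lookup e k) (subst (V.lookup e k ∈_) (lookup-rootSets e k) ek∈)

    G-root : ∀ e y → (∀ k → V.lookup y k ∈ values k) → y ≢ e → G e y ≡ 0ℤ
    G-root e y y∈values y≢e with ≢⇒∃lookup≢ y≢e
    ... | k , yk≢ek = separator-root (rootSets e) y k
            (subst (V.lookup y k ∈_) (sym (lookup-rootSets e k)) (∈-others (y∈values k) yk≢ek))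

    sum-values≤ : ∀ k → sum (values k) ≤ 2 * n
    sum-values≤ k = begin
      sum (column α k ++ column β k)          ≡⟨ sum-++ (column α k) (column β k) ⟩
      sum (column α k) + sum (column β k)     ≤⟨ ℕP.+-mono-≤ (ℕP.≤-trans (sum-column≤totalNorm α k) α≤n)
                                                              (ℕP.≤-trans (sum-column≤totalNorm β k) β≤n) ⟩
      n + n                                   ≡⟨ double n ⟩
      2 * n                                   ∎
      where
      open ℕP.≤-Reasoning
      double : ∀ n → n + n ≡ 2 * n
      double = solve-∀

    degree≤γ : ∀ e k → length (others (values k) (V.lookup e k)) ≤ γ n
    degree≤γ e k = ≤γ n (begin
      r * r             ≤⟨ others-length (values k) (V.lookup e k) ⟩
      2 * sum (values k) + r ≤⟨ ℕP.+-monoˡ-≤ r (ℕP.*-monoʳ-≤ 2 (sum-values≤ k)) ⟩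
      2 * (2 * n) + r   ≡⟨ cong (_+ r) (ℕP.*-assoc 2 2 n) ⟨
      4 * n + r         ∎)
      where
      open ℕP.≤-Reasoning
      r = length (others (values k) (V.lookup e k))

    moments-agree⇒related : ∀ {ℓ} → (∀ i → All (_≤ ℓ) i → sumF α i ≡ sumF β i) → γ n ≤ ℓ → RelatedByPerm α β
    moments-agree⇒related moments γn≤ℓ =
      related-by-separators (VP.≡-dec _≟_) α β G (G-nonzero ∘ α)
        (λ t u → G-root (α t) (α u) λ k → ∈-++⁺ˡ (∈-tabulate⁺ u))
        (λ t u → G-root (α t) (β u) λ k → ∈-++⁺ʳ (column α k) (∈-tabulate⁺ u))
        λ t → combination-sums-agree α β moments (separator-combination (rootSets (α t)))
                (AllP.map⁺ (AllP.tabulate⁺ λ k → ℕP.≤-trans (degree≤γ (α t) k) γn≤ℓ))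

module ExponentialBound where

  open import Data.Nat as ℕ using (ℕ; zero; suc)
  import Data.Nat.Properties as ℕP
  import Data.Nat.Coprimality as Coprime
  open import Data.Integer as ℤ using (+_)
  import Data.Integer.Properties as ℤP
  open import Data.Rational using (ℚ; 0ℚ; 1ℚ; ½; _/_; _+_; _*_; _≤_; mkℚ; *≤*; nonNegative)
  import Data.Rational.Properties as ℚP
  open import Data.Rational.Solver using (module +-*-Solver)
  open import Relation.Nullary.Decidable using (from-yes)

  natℚ : ℕ → ℚ
  natℚ n = + n / 1

  natℚ-≡-mkℚ : ∀ n → natℚ n ≡ mkℚ (+ n) 0 (Coprime.sym (Coprime.1-coprimeTo n))
  natℚ-≡-mkℚ n = ℚP.normalize-coprime (Coprime.sym (Coprime.1-coprimeTo n))

  natℚ-mono : ∀ {m n} → m ℕ.≤ n → natℚ m ≤ natℚ n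
  natℚ-mono {m} {n} m≤n rewrite natℚ-≡-mkℚ m | natℚ-≡-mkℚ n =
    *≤* (subst₂ ℤ._≤_ (sym (ℤP.*-identityʳ (+ m))) (sym (ℤP.*-identityʳ (+ n))) (ℤ.+≤+ m≤n))

  natℚ-* : ∀ m n → natℚ m * natℚ n ≡ natℚ (m ℕ.* n)
  natℚ-* m n rewrite natℚ-≡-mkℚ m | natℚ-≡-mkℚ n = cong (_/ 1) (sym (ℤP.pos-* m n))

  natℚ-nonneg : ∀ n → 0ℚ ≤ natℚ n
  natℚ-nonneg n = natℚ-mono {0} {n} ℕ.z≤n

  *-nonneg : ∀ {a b} → 0ℚ ≤ a → 0ℚ ≤ b → 0ℚ ≤ a * b
  *-nonneg {a} {b} 0≤a 0≤b =
    ℚP.nonNegative⁻¹ (a * b) {{ℚP.nonNeg*nonNeg⇒nonNeg a {{nonNegative 0≤a}} b {{nonNegative 0≤b}}}}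

  *-mono-≤-nonneg : ∀ {a b c d} → 0ℚ ≤ b → 0ℚ ≤ c → a ≤ b → c ≤ d → a * c ≤ b * d
  *-mono-≤-nonneg {a} {b} {c} {d} 0≤b 0≤c a≤b c≤d =
    ℚP.≤-trans (ℚP.*-monoʳ-≤-nonNeg c {{nonNegative 0≤c}} a≤b) (ℚP.*-monoˡ-≤-nonNeg b {{nonNegative 0≤b}} c≤d)

  x≤x+y : ∀ x {y} → 0ℚ ≤ y → x ≤ x + y
  x≤x+y x {y} 0≤y = ℚP.≤-trans (ℚP.≤-reflexive (sym (ℚP.+-identityʳ x))) (ℚP.+-monoʳ-≤ x 0≤y)

  1/[1+k] : ℕ → ℚ
  1/[1+k] k = + 1 / suc k

  1/[1+k]-nonneg : ∀ k → 0ℚ ≤ 1/[1+k] k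
  1/[1+k]-nonneg k = ℚP.nonNegative⁻¹ (1/[1+k] k) {{ℚP.normalize-nonNeg 1 (suc k)}}

  1/[1+k]≤1/6 : ∀ k → 5 ℕ.≤ k → 1/[1+k] k ≤ 1/[1+k] 5
  1/[1+k]≤1/6 k 5≤k rewrite ℚP.normalize-coprime {1} {k} (Coprime.1-coprimeTo (suc k)) =
    *≤* (subst₂ ℤ._≤_ (sym (ℤP.*-identityˡ (+ 6))) (sym (ℤP.*-identityˡ (+ suc k))) (ℤ.+≤+ (ℕ.s≤s 5≤k)))

  expTerm-nonneg : ∀ {a} → 0ℚ ≤ a → ∀ k → 0ℚ ≤ expTerm a k
  expTerm-nonneg 0≤a zero    = from-yes (0ℚ ℚP.≤? 1ℚ)
  expTerm-nonneg 0≤a (suc k) = *-nonneg (expTerm-nonneg 0≤a k) (*-nonneg 0≤a (1/[1+k]-nonneg k))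

  expTerm-mono : ∀ {a b} → 0ℚ ≤ a → a ≤ b → ∀ k → expTerm a k ≤ expTerm b k
  expTerm-mono 0≤a a≤b zero    = ℚP.≤-refl
  expTerm-mono 0≤a a≤b (suc k) =
    *-mono-≤-nonneg (expTerm-nonneg (ℚP.≤-trans 0≤a a≤b) k) (*-nonneg 0≤a (1/[1+k]-nonneg k)) (expTerm-mono 0≤a a≤b k)
      (ℚP.*-monoʳ-≤-nonNeg (1/[1+k] k) {{nonNegative (1/[1+k]-nonneg k)}} a≤b)

  expPartial-mono : ∀ {a b} → 0ℚ ≤ a → a ≤ b → ∀ K → expPartial a K ≤ expPartial b K
  expPartial-mono 0≤a a≤b zero    = ℚP.≤-refl
  expPartial-mono 0≤a a≤b (suc K) = ℚP.+-mono-≤ (expPartial-mono 0≤a a≤b K) (expTerm-mono 0≤a a≤b K)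

  expPartial-≤-+ : ∀ {a} → 0ℚ ≤ a → ∀ K j → expPartial a K ≤ expPartial a (j ℕ.+ K)
  expPartial-≤-+ 0≤a K zero    = ℚP.≤-refl
  expPartial-≤-+ {a} 0≤a K (suc j) =
    ℚP.≤-trans (expPartial-≤-+ 0≤a K j) (x≤x+y (expPartial a (j ℕ.+ K)) (expTerm-nonneg 0≤a (j ℕ.+ K)))

  0≤3 : 0ℚ ≤ natℚ 3
  0≤3 = natℚ-nonneg 3

  expTerm3-halves : ∀ k → 5 ℕ.≤ k → expTerm (natℚ 3) (suc k) ≤ expTerm (natℚ 3) k * ½
  expTerm3-halves k 5≤k = ℚP.*-monoˡ-≤-nonNeg (expTerm (natℚ 3) k) {{nonNegative (expTerm-nonneg 0≤3 k)}}
    (ℚP.*-monoˡ-≤-nonNeg (natℚ 3) {{nonNegative 0≤3}} (1/[1+k]≤1/6 k 5≤k))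

  -- From k = 6 on the terms of e³ at least halve, so the tail is bounded by a geometric series (e³ ≈ 20.09).
  expPartial3-tail : ∀ j → expPartial (natℚ 3) (6 ℕ.+ j) + natℚ 2 * expTerm (natℚ 3) (6 ℕ.+ j) ≤ natℚ 21
  expPartial3-tail zero    = from-yes (expPartial (natℚ 3) 6 + natℚ 2 * expTerm (natℚ 3) 6 ℚP.≤? natℚ 21)
  expPartial3-tail (suc j) = begin
    P + T + natℚ 2 * expTerm (natℚ 3) (suc (6 ℕ.+ j)) ≤⟨ ℚP.+-monoʳ-≤ (P + T)
      (ℚP.*-monoˡ-≤-nonNeg (natℚ 2) {{nonNegative (natℚ-nonneg 2)}} (expTerm3-halves (6 ℕ.+ j) (ℕP.m≤m+n 5 (suc j)))) ⟩
    P + T + natℚ 2 * (T * ½)                         ≡⟨ halve-twice P T ⟩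
    P + natℚ 2 * T                                   ≤⟨ expPartial3-tail j ⟩
    natℚ 21                                          ∎
    where
    open ℚP.≤-Reasoning
    open +-*-Solver
    P = expPartial (natℚ 3) (6 ℕ.+ j)
    T = expTerm (natℚ 3) (6 ℕ.+ j)
    halve-twice : ∀ P T → P + T + natℚ 2 * (T * ½) ≡ P + natℚ 2 * T
    halve-twice = solve 2 (λ P T → P :+ T :+ con (natℚ 2) :* (T :* con ½) := P :+ con (natℚ 2) :* T) refl

  expPartial≤21 : ∀ {a} → 0ℚ ≤ a → a ≤ natℚ 3 → ∀ K → expPartial a K ≤ natℚ 21
  expPartial≤21 {a} 0≤a a≤3 K = begin
    expPartial a K                ≤⟨ expPartial-mono 0≤a a≤3 K ⟩
    expPartial (natℚ 3) K         ≤⟨ expPartial-≤-+ 0≤3 K 6 ⟩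
    expPartial (natℚ 3) (6 ℕ.+ K) ≤⟨ x≤x+y _ (*-nonneg (natℚ-nonneg 2) (expTerm-nonneg 0≤3 (6 ℕ.+ K))) ⟩
    expPartial (natℚ 3) (6 ℕ.+ K) + natℚ 2 * expTerm (natℚ 3) (6 ℕ.+ K) ≤⟨ expPartial3-tail K ⟩
    natℚ 21                       ∎
    where open ℚP.≤-Reasoning

module Asymptotics where

  open DegreeThreshold using (γ; γ-square-≤-9n)
  open ExponentialBound
  open import Data.Nat as ℕ using (ℕ)
  open import Data.Rational using (0ℚ; 1ℚ; _+_; _*_; _≤_; _<_; nonNegative)
  import Data.Rational.Properties as ℚP
  open import Data.Product using (_,_)
  open import Relation.Nullary using (yes; no; contradiction)

  x*x*n<9*n⇒x<3 : ∀ {x} n → 0ℚ ≤ x → x * x * natℚ n < natℚ (9 ℕ.* n) → x < natℚ 3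
  x*x*n<9*n⇒x<3 {x} n 0≤x x²n<9n with x ℚP.<? natℚ 3
  ... | yes x<3 = x<3
  ... | no  x≮3 = contradiction (ℚP.<-≤-trans x²n<9n (begin
    natℚ (9 ℕ.* n)          ≡⟨ natℚ-* 9 n ⟨
    natℚ 9 * natℚ n         ≤⟨ ℚP.*-monoʳ-≤-nonNeg (natℚ n) {{nonNegative (natℚ-nonneg n)}} 9≤x² ⟩
    x * x * natℚ n          ∎)) (ℚP.<-irrefl refl)
    where
    open ℚP.≤-Reasoning
    3≤x = ℚP.≮⇒≥ x≮3
    9≤x² : natℚ 9 ≤ x * x
    9≤x² = *-mono-≤-nonneg 0≤x 0≤3 3≤x 3≤x

  γ-asymptotic : AsympBound γ
  γ-asymptotic ε 0<ε = 21 , λ n 21≤n 1≤n a 0≤a scaled<γ² K →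
    ℚP.≤-trans (expPartial≤21 0≤a (a≤3 n 1≤n a 0≤a scaled<γ²) K) (natℚ-mono 21≤n)
    where
    c = 1ℚ + ε
    1≤c : 1ℚ ≤ c
    1≤c = x≤x+y 1ℚ (ℚP.<⇒≤ 0<ε)
    a≤3 : ∀ n → 1 ℕ.≤ n → ∀ a → 0ℚ ≤ a → a * c * (a * c) * natℚ n < natℚ (γ n ℕ.* γ n) → a ≤ natℚ 3
    a≤3 n 1≤n a 0≤a scaled<γ² = ℚP.<⇒≤ (ℚP.≤-<-trans a≤ac ac<3)
      where
      a≤ac : a ≤ a * c
      a≤ac = ℚP.≤-trans (ℚP.≤-reflexive (sym (ℚP.*-identityʳ a))) (ℚP.*-monoˡ-≤-nonNeg a {{nonNegative 0≤a}} 1≤c)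
      ac<3 : a * c < natℚ 3
      ac<3 = x*x*n<9*n⇒x<3 n (ℚP.≤-trans 0≤a a≤ac) (ℚP.<-≤-trans scaled<γ² (natℚ-mono (γ-square-≤-9n 1≤n)))

open import Data.Nat using (ℕ; _≤_; _<_)
import Data.Nat.Properties as ℕP
open import Data.Vec.Relation.Unary.All using (All)
open import Data.Product using (∃; _×_; _,_)
open import Relation.Nullary using (¬_)
open DegreeThreshold using (γ)
open Reconstruction using (moments-agree⇒related)
open Asymptotics using (γ-asymptotic)

lemma3p1 : ∀ (s : ℕ) → 1 ≤ s →
    ∃ λ (γ : ℕ → ℕ) → AsympBound γ ×
      (∀ (m n ℓ : ℕ) (α β : Fin m → Vec ℕ s) →
        ¬ RelatedByPerm α β →
        totalNorm α ≤ n → totalNorm β ≤ n →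
        (∀ (i : Vec ℕ s) → All (_≤ ℓ) i → sumF α i ≡ sumF β i) →
        ℓ < γ n)
lemma3p1 s _ = γ , γ-asymptotic , λ m n ℓ α β unrelated α≤n β≤n moments →
  ℕP.≰⇒> λ γn≤ℓ → unrelated (moments-agree⇒related α β α≤n β≤n moments γn≤ℓ)
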